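{- Let $d\geq1$ and $q\geq1$ be coprime integers, $f=\mathrm{ord}_d(q)$, and let $\mathcal{P}$ be the proposition "$2\,\|\,d$, $q\equiv3\pmod4$ and $f$ is odd". Then for every positive integer $v$ dividing some power of $d$, \[ \mathrm{ord}_{dv}(q)=fdv\cdot\begin{cases}\dfrac{2}{(q^{2f}-1,dv)},&\text{if }\mathcal{P}\text{ holds and }2\mid v;\\[2mm] \dfrac{1}{(q^f-1,dv)},&\text{otherwise}.\end{cases} \]
   Context: $\mathrm{ord}_n(q)$ is the multiplicative order of $q$ modulo $n$; $(x,y)$ is the gcd; $2\,\|\,d$ means $2\mid d$ and $4\nmid d$. -}

module Defs where

open import Data.Nat using (ℕ; zero; suc; _+_; _*_; _∸_; _^_; _≤_; _<_)
open import Data.Nat.Divisibility using (_∣_)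
open import Data.Nat.GCD using (gcd)
open import Data.Nat.DivMod using (_/_)
open import Data.Product using (_×_)

-- q^k ≡ 1 (mod n), for q ≥ 1 (so q^k ≥ 1 and q^k ∸ 1 is the true difference)
PowOne : ℕ → ℕ → ℕ → Set
PowOne n q k = n ∣ (q ^ k ∸ 1)

IsOrd : ℕ → ℕ → ℕ → Set
IsOrd n q k = (1 ≤ k) × PowOne n q k × (∀ j → 1 ≤ j → j < k → PowOne n q j → Data.Empty.⊥)
  where import Data.Empty

-- exact division a / b (b is always nonzero where used; returns 0 if b = 0)
_div_ : ℕ → ℕ → ℕ
a div zero = 0
a div (suc b) = a / suc b

Exactly2 : ℕ → Set
Exactly2 d = (2 ∣ d) × (4 ∣ d → Data.Empty.⊥)
  where import Data.Empty

OddN : ℕ → Set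
OddN f = (2 ∣ f → Data.Empty.⊥)
  where import Data.Empty

P : ℕ → ℕ → ℕ → Set
P d q f = Exactly2 d × (4 ∣ (q + 1)) × OddN f

module Submission where

-- Write q ^ e = 1 + b. Lifting the exponent: if every prime factor of N divides b, and 4 ∣ b when 4 ∣ N,
-- then q ^ (e j) ≡ 1 (mod N) exactly when N / gcd(b, N) divides j. This is proved one prime at a time
-- along a factorisation of N / gcd(b, N), from the fact that for p ∣ a (and 4 ∣ a if p = 2) the number
-- ((1 + a) ^ p − 1) / a is p times a number prime to p. Hence, if e divides every j with
-- q ^ j ≡ 1 (mod N), the order of q modulo N is e N / gcd(b, N).
-- For N = d v the prime factors are those of d, as v ∣ d ^ m, and f divides every such j.
-- Outside 𝒫 take e = f: then d ∣ b, and 4 ∣ d v with 4 ∤ b forces 2 ∥ d, 2 ∣ v, q ≡ 3 (mod 4) and f odd,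
-- which is 𝒫. Under 𝒫, q ^ j ≡ 1 (mod 4) forces j to be even, so take e = 2 f; then 4 ∣ b as q is odd.

open import Defs
open import Data.Empty using (⊥; ⊥-elim)
open import Data.List.Base using ([]; _∷_)
open import Data.List.Relation.Unary.All using (All; []; _∷_)
open import Data.Nat using (ℕ; zero; suc; 2+; _+_; _*_; _∸_; _^_; _≤_; _<_; s≤s; z≤n; NonZero; NonTrivial;
  nonTrivial⇒nonZero; nonTrivial⇒≢1; ≢-nonZero; ≢-nonZero⁻¹; >-nonZero; >-nonZero⁻¹)
open import Data.Nat.Coprimality as Coprimality using (Coprime; coprime-divisor; coprime-/gcd)
open import Data.Nat.DivMod using (_/_; _%_; m*[n/m]≡n; *-/-assoc; m%n<n; m≡m%n+[m/n]*n)
open import Data.Nat.Divisibility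
open import Data.Nat.GCD using (gcd; gcd[m,n]≢0; gcd[m,n]∣m; gcd[m,n]∣n; gcd-greatest; n/gcd[m,n]≢0)
open import Data.Nat.ListAction using (product)
open import Data.Nat.Primality using (Prime; prime[2]; ¬prime[1]; euclidsLemma; prime⇒irreducible; prime⇒nonZero)
open import Data.Nat.Primality.Factorisation using (factorise)
open import Data.Nat.Properties
open import Data.Nat.Solver using (module +-*-Solver)
open import Data.Product using (_×_; _,_; proj₁; proj₂; ∃-syntax)
open import Data.Sum using (_⊎_; inj₁; inj₂; [_,_]′)
open import Function.Base using (_∘_; id)
open import Function.Bundles using (_⇔_; mk⇔; Equivalence)
open import Function.Construct.Symmetry using (⇔-sym)
open import Function.Related.Propositional as Related using ()
open import Relation.Binary.PropositionalEquality
open import Relation.Nullary using (¬_; yes; no; contradiction)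

open +-*-Solver

*-div-assoc : ∀ m {n} d → d ∣ n → (m * n) div d ≡ m * (n div d)
*-div-assoc m zero    _   = sym (*-zeroʳ m)
*-div-assoc m (suc d) d∣n = *-/-assoc m d∣n

div≡/ : ∀ m n → .{{_ : NonZero n}} → m div n ≡ m / n
div≡/ m (suc n) = refl

suc[n∸1]≡n : ∀ n → .{{NonZero n}} → suc (n ∸ 1) ≡ n
suc[n∸1]≡n (suc n) = refl

gcd≢0ʳ : ∀ m n → .{{NonZero n}} → NonZero (gcd m n)
gcd≢0ʳ m n = ≢-nonZero (gcd[m,n]≢0 m n (inj₂ (≢-nonZero⁻¹ n)))

*-cancelˡ-∣-⇔ : ∀ {m n} o → .{{NonZero o}} → o * m ∣ o * n ⇔ m ∣ n
*-cancelˡ-∣-⇔ o = mk⇔ (*-cancelˡ-∣ o) (*-monoʳ-∣ o)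

coprime-∣*-⇔ : ∀ {m u n} → Coprime m u → m ∣ u * n ⇔ m ∣ n
coprime-∣*-⇔ {u = u} m⊥u = mk⇔ (coprime-divisor m⊥u) (∣n⇒∣m*n u)

⇔-from-multiples : ∀ {P Q : ℕ → Set} e → (∀ {j} → P j → e ∣ j) → (∀ {j} → Q j → e ∣ j) →
                   (∀ t → P (e * t) ⇔ Q (e * t)) → ∀ j → P j ⇔ Q j
⇔-from-multiples {P} {Q} e e∣P e∣Q at-multiples j = mk⇔
  (λ Pj → Equivalence.to   (at-multiple (e∣P Pj)) Pj)
  (λ Qj → Equivalence.from (at-multiple (e∣Q Qj)) Qj)
  where
  at-multiple : e ∣ j → P j ⇔ Q j
  at-multiple (divides t refl) = subst (λ k → P k ⇔ Q k) (*-comm e t) (at-multiples t)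

prime∤1 : ∀ {p} → Prime p → ¬ p ∣ 1
prime∤1 p-prime p∣1 = contradiction (subst Prime (∣1⇒≡1 p∣1) p-prime) ¬prime[1]

prime∣prime⇒≡ : ∀ {p q} → Prime p → Prime q → p ∣ q → p ≡ q
prime∣prime⇒≡ p-prime q-prime p∣q with prime⇒irreducible q-prime p∣q
... | inj₁ refl = contradiction p-prime ¬prime[1]
... | inj₂ p≡q  = p≡q

∃-prime-divisor : ∀ n → .{{NonTrivial n}} → ∃[ p ] Prime p × p ∣ n
∃-prime-divisor n with factorise n {{nonTrivial⇒nonZero n}}
... | record { factors = [] ; isFactorisation = n≡1 } = contradiction n≡1 nonTrivial⇒≢1
... | record { factors = p ∷ ps ; isFactorisation = n≡p*∏ps ; factorsPrime = p-prime ∷ _ } =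
  p , p-prime , subst (p ∣_) (sym n≡p*∏ps) (m∣m*n (product ps))

¬common-prime⇒coprime : ∀ {m n} → (∀ {p} → Prime p → p ∣ m → p ∣ n → ⊥) → Coprime m n
¬common-prime⇒coprime none {0} (0∣m , 0∣n) = ⊥-elim (none prime[2] (∣-trans (2 ∣0) 0∣m) (∣-trans (2 ∣0) 0∣n))
¬common-prime⇒coprime none {1} _            = refl
¬common-prime⇒coprime none {i@(2+ _)} (i∣m , i∣n) with ∃-prime-divisor i
... | p , p-prime , p∣i = ⊥-elim (none p-prime (∣-trans p∣i i∣m) (∣-trans p∣i i∣n))

prime∣^⇒∣ : ∀ {p m} n → Prime p → p ∣ m ^ n → p ∣ m
prime∣^⇒∣         zero    p-prime p∣1 = contradiction p∣1 (prime∤1 p-prime)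
prime∣^⇒∣ {m = m} (suc n) p-prime p∣m^[1+n] with euclidsLemma m (m ^ n) p-prime p∣m^[1+n]
... | inj₁ p∣m   = p∣m
... | inj₂ p∣m^n = prime∣^⇒∣ n p-prime p∣m^n

PrimeDivisorsDivide : ℕ → ℕ → Set
PrimeDivisorsDivide m n = ∀ {p} → Prime p → p ∣ m → p ∣ n

∣^⇒primeDivisorsDivide : ∀ {d v} m → v ∣ d ^ m → PrimeDivisorsDivide (d * v) d
∣^⇒primeDivisorsDivide {d} {v} m v∣d^m p-prime p∣d*v with euclidsLemma d v p-prime p∣d*v
... | inj₁ p∣d = p∣d
... | inj₂ p∣v = prime∣^⇒∣ m p-prime (∣-trans p∣v v∣d^m)

geom : ℕ → ℕ → ℕ
geom b zero    = 0
geom b (suc k) = geom b k + b ^ k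

geom-+ : ∀ b m n → geom b (m + n) ≡ geom b m + b ^ m * geom b n
geom-+ b m zero rewrite +-identityʳ m | *-zeroʳ (b ^ m) = sym (+-identityʳ (geom b m))
geom-+ b m (suc n) rewrite +-suc m n = begin
  geom b (m + n) + b ^ (m + n)                   ≡⟨ cong₂ _+_ (geom-+ b m n) (^-distribˡ-+-* b m n) ⟩
  geom b m + b ^ m * geom b n + b ^ m * b ^ n    ≡⟨ solve 4 (λ x y z w → x :+ y :* z :+ y :* w := x :+ y :* (z :+ w)) refl (geom b m) (b ^ m) (geom b n) (b ^ n) ⟩
  geom b m + b ^ m * (geom b n + b ^ n)          ∎
  where open ≡-Reasoning

geom-* : ∀ b m n → geom b (m * n) ≡ geom b m * geom (b ^ m) n
geom-* b m zero rewrite *-zeroʳ m = sym (*-zeroʳ (geom b m))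
geom-* b m (suc n) = begin
  geom b (m * suc n)                                 ≡⟨ cong (geom b) (trans (*-suc m n) (+-comm m (m * n))) ⟩
  geom b (m * n + m)                                 ≡⟨ geom-+ b (m * n) m ⟩
  geom b (m * n) + b ^ (m * n) * geom b m            ≡⟨ cong₂ (λ x y → x + y * geom b m) (geom-* b m n) (sym (^-*-assoc b m n)) ⟩
  geom b m * geom (b ^ m) n + (b ^ m) ^ n * geom b m  ≡⟨ solve 3 (λ x y z → x :* y :+ z :* x := x :* (y :+ z)) refl (geom b m) (geom (b ^ m) n) ((b ^ m) ^ n) ⟩
  geom b m * geom (b ^ m) (suc n)                    ∎
  where open ≡-Reasoning

suc^≡suc[*geom] : ∀ a k → suc a ^ k ≡ suc (a * geom (suc a) k)
suc^≡suc[*geom] a zero    = cong suc (sym (*-zeroʳ a))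
suc^≡suc[*geom] a (suc k) = begin
  suc a * suc a ^ k                                      ≡⟨ cong (suc a *_) (suc^≡suc[*geom] a k) ⟩
  suc a * suc (a * geom (suc a) k)                       ≡⟨ solve 2 (λ a s → (con 1 :+ a) :* (con 1 :+ a :* s) := con 1 :+ a :* (s :+ (con 1 :+ a :* s))) refl a (geom (suc a) k) ⟩
  suc (a * (geom (suc a) k + suc (a * geom (suc a) k)))  ≡⟨ cong (λ x → suc (a * (geom (suc a) k + x))) (sym (suc^≡suc[*geom] a k)) ⟩
  suc (a * geom (suc a) (suc k))                         ∎
  where open ≡-Reasoning

^∸1≡[∸1]*geom : ∀ b k → b ^ k ∸ 1 ≡ (b ∸ 1) * geom b k
^∸1≡[∸1]*geom zero    zero    = refl
^∸1≡[∸1]*geom zero    (suc k) = refl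
^∸1≡[∸1]*geom (suc a) k       = cong (_∸ 1) (suc^≡suc[*geom] a k)

choose2 : ℕ → ℕ
choose2 zero    = 0
choose2 (suc k) = choose2 k + k

choose2[1+k]*2≡[1+k]*k : ∀ k → choose2 (suc k) * 2 ≡ suc k * k
choose2[1+k]*2≡[1+k]*k zero    = refl
choose2[1+k]*2≡[1+k]*k (suc k) = begin
  (choose2 (suc k) + suc k) * 2   ≡⟨ *-distribʳ-+ 2 (choose2 (suc k)) (suc k) ⟩
  choose2 (suc k) * 2 + suc k * 2 ≡⟨ cong (_+ suc k * 2) (choose2[1+k]*2≡[1+k]*k k) ⟩
  suc k * k + suc k * 2           ≡⟨ solve 1 (λ k → (con 1 :+ k) :* k :+ (con 1 :+ k) :* con 2 := (con 2 :+ k) :* (con 1 :+ k)) refl k ⟩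
  suc (suc k) * suc k             ∎
  where open ≡-Reasoning

prime∣choose2 : ∀ {p} → Prime p → p ≢ 2 → p ∣ choose2 p
prime∣choose2 {suc p′} p-prime p≢2
  with euclidsLemma (choose2 (suc p′)) 2 p-prime
         (subst (suc p′ ∣_) (sym (choose2[1+k]*2≡[1+k]*k p′)) (m∣m*n p′))
... | inj₁ p∣choose2 = p∣choose2
... | inj₂ p∣2       = contradiction (prime∣prime⇒≡ p-prime prime[2] p∣2) p≢2

suc^-expansion : ∀ a k → ∃[ r ] suc a ^ k ≡ suc (k * a + a * a * r)
suc^-expansion a zero = 0 , cong suc (sym (*-zeroʳ (a * a)))
suc^-expansion a (suc k) with suc^-expansion a k
... | r , eq = k + r + a * r , (begin
  suc a * suc a ^ k                          ≡⟨ cong (suc a *_) eq ⟩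
  suc a * suc (k * a + a * a * r)            ≡⟨ solve 3 (λ a k r → (con 1 :+ a) :* (con 1 :+ (k :* a :+ a :* a :* r)) := con 1 :+ ((con 1 :+ k) :* a :+ a :* a :* (k :+ r :+ a :* r))) refl a k r ⟩
  suc (suc k * a + a * a * (k + r + a * r))  ∎)
  where open ≡-Reasoning

geom-expansion : ∀ a k → ∃[ r ] geom (suc a) k ≡ k + a * choose2 k + a * a * r
geom-expansion a zero = 0 , sym (cong₂ _+_ (*-zeroʳ a) (*-zeroʳ (a * a)))
geom-expansion a (suc k) with geom-expansion a k | suc^-expansion a k
... | r , eq | s , eq′ = r + s , (begin
  geom (suc a) k + suc a ^ k                               ≡⟨ cong₂ _+_ eq eq′ ⟩
  k + a * choose2 k + a * a * r + suc (k * a + a * a * s)  ≡⟨ solve 5 (λ a k c r s → k :+ a :* c :+ a :* a :* r :+ (con 1 :+ (k :* a :+ a :* a :* s)) := con 1 :+ k :+ a :* (c :+ k) :+ a :* a :* (r :+ s)) refl a k (choose2 k) r s ⟩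
  suc k + a * choose2 (suc k) + a * a * (r + s)            ∎)
  where open ≡-Reasoning

∣a⇒∣geom⇔∣ : ∀ {m a} k → m ∣ a → m ∣ geom (suc a) k ⇔ m ∣ k
∣a⇒∣geom⇔∣ {m} {a} k m∣a = mk⇔
  (λ m∣geom → ∣m+n∣m⇒∣n (subst (m ∣_) geom≡ m∣geom) m∣multiple)
  (λ m∣k → subst (m ∣_) (sym geom≡) (∣m∣n⇒∣m+n m∣multiple m∣k))
  where
  r = proj₁ (geom-expansion a k)
  x = choose2 k + a * r
  geom≡ : geom (suc a) k ≡ a * x + k
  geom≡ = trans (proj₂ (geom-expansion a k))
    (solve 4 (λ k a c r → k :+ a :* c :+ a :* a :* r := a :* (c :+ a :* r) :+ k) refl k a (choose2 k) r)
  m∣multiple : m ∣ a * x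
  m∣multiple = ∣m⇒∣m*n x m∣a

p∥geom[p] : ∀ {p a} → Prime p → p ∣ a → (p ≡ 2 → 4 ∣ a) →
             ∃[ u ] geom (suc a) p ≡ p * u × ¬ p ∣ u
p∥geom[p] {p} {a} p-prime p∣a 4∣a = suc (p * x) , geom≡ , p∤1+p*x
  where
  r = proj₁ (geom-expansion a p)
  p²∣a*choose2 : p * p ∣ a * choose2 p
  p²∣a*choose2 with p ≟ 2
  ... | yes refl = ∣m⇒∣m*n 1 (4∣a refl)
  ... | no p≢2   = *-pres-∣ p∣a (prime∣choose2 p-prime p≢2)
  p²∣higher-terms : p * p ∣ a * choose2 p + a * a * r
  p²∣higher-terms = ∣m∣n⇒∣m+n p²∣a*choose2 (∣m⇒∣m*n r (*-pres-∣ p∣a p∣a))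
  x = quotient p²∣higher-terms
  geom≡ : geom (suc a) p ≡ p * suc (p * x)
  geom≡ = begin
    geom (suc a) p                   ≡⟨ proj₂ (geom-expansion a p) ⟩
    p + a * choose2 p + a * a * r    ≡⟨ +-assoc p _ _ ⟩
    p + (a * choose2 p + a * a * r)  ≡⟨ cong (p +_) (m∣n⇒n≡quotient*m p²∣higher-terms) ⟩
    p + x * (p * p)                  ≡⟨ solve 2 (λ p x → p :+ x :* (p :* p) := p :* (con 1 :+ p :* x)) refl p x ⟩
    p * suc (p * x)                  ∎
    where open ≡-Reasoning
  p∤1+p*x : ¬ p ∣ suc (p * x)
  p∤1+p*x p∣1+p*x = prime∤1 p-prime (∣m+n∣m⇒∣n (subst (p ∣_) (+-comm 1 (p * x)) p∣1+p*x) (m∣m*n x))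

∣geom⇔∣-step : ∀ {p a M} → Prime p → p ∣ a → (p ≡ 2 → 4 ∣ a) → PrimeDivisorsDivide M a →
               (∀ j → M ∣ geom (suc a ^ p) j ⇔ M ∣ j) →
               ∀ k → p * M ∣ geom (suc a) k ⇔ p * M ∣ k
∣geom⇔∣-step {p} {a} {M} p-prime p∣a 4∣a rad IH =
  ⇔-from-multiples p (λ pM∣geom → Equivalence.to (∣a⇒∣geom⇔∣ _ p∣a) (∣-trans (m∣m*n M) pM∣geom))
                     (∣-trans (m∣m*n M)) λ j → begin
    p * M ∣ geom (suc a) (p * j)                  ≡⟨ cong (p * M ∣_) (geom-* (suc a) p j) ⟩
    p * M ∣ geom (suc a) p * geom (suc a ^ p) j   ≡⟨ cong (λ x → p * M ∣ x * geom (suc a ^ p) j) geom[p]≡p*u ⟩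
    p * M ∣ p * u * geom (suc a ^ p) j            ≡⟨ cong (p * M ∣_) (*-assoc p u _) ⟩
    p * M ∣ p * (u * geom (suc a ^ p) j)          ∼⟨ *-cancelˡ-∣-⇔ p ⟩
    M ∣ u * geom (suc a ^ p) j                    ∼⟨ coprime-∣*-⇔ M⊥u ⟩
    M ∣ geom (suc a ^ p) j                        ∼⟨ IH j ⟩
    M ∣ j                                         ∼⟨ ⇔-sym (*-cancelˡ-∣-⇔ p) ⟩
    p * M ∣ p * j                                 ∎
  where
  open Related.EquationalReasoning
  instance _ = prime⇒nonZero p-prime
  u = proj₁ (p∥geom[p] p-prime p∣a 4∣a)
  geom[p]≡p*u = proj₁ (proj₂ (p∥geom[p] p-prime p∣a 4∣a))
  p∤u = proj₂ (proj₂ (p∥geom[p] p-prime p∣a 4∣a))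
  M⊥u : Coprime M u
  M⊥u = ¬common-prime⇒coprime λ {r} r-prime r∣M r∣u →
    let r∣geom[p] = subst (r ∣_) (sym geom[p]≡p*u) (∣n⇒∣m*n p r∣u)
        r∣p       = Equivalence.to (∣a⇒∣geom⇔∣ p (rad r-prime r∣M)) r∣geom[p]
    in p∤u (subst (_∣ u) (prime∣prime⇒≡ r-prime p-prime r∣p) r∣u)

-- Splitting off a prime p of the modulus replaces the base 1 + a by (1 + a) ^ p = 1 + a * geom (1 + a) p,
-- and a * geom (1 + a) p satisfies both hypotheses again.
∏∣geom⇔∏∣ : ∀ {ps a} → All Prime ps → PrimeDivisorsDivide (product ps) a → (2 ∣ product ps → 4 ∣ a) →
            ∀ k → product ps ∣ geom (suc a) k ⇔ product ps ∣ k
∏∣geom⇔∏∣ [] _ _ k = mk⇔ (λ _ → 1∣ k) (λ _ → 1∣ _)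
∏∣geom⇔∏∣ {p ∷ ps} {a} (p-prime ∷ ps-prime) rad 4∣a =
  ∣geom⇔∣-step p-prime (rad p-prime (m∣m*n (product ps))) (λ { refl → 4∣a (m∣m*n (product ps)) })
               (λ r-prime → rad r-prime ∘ ∣n⇒∣m*n p) IH
  where
  IH : ∀ j → product ps ∣ geom (suc a ^ p) j ⇔ product ps ∣ j
  IH = subst (λ b → ∀ j → product ps ∣ geom b j ⇔ product ps ∣ j) (sym (suc^≡suc[*geom] a p))
         (∏∣geom⇔∏∣ ps-prime (λ r-prime → ∣m⇒∣m*n _ ∘ rad r-prime ∘ ∣n⇒∣m*n p) (∣m⇒∣m*n _ ∘ 4∣a ∘ ∣n⇒∣m*n p))

∣geom⇔∣ : ∀ {M a} → .{{NonZero M}} → PrimeDivisorsDivide M a → (2 ∣ M → 4 ∣ a) →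
          ∀ k → M ∣ geom (suc a) k ⇔ M ∣ k
∣geom⇔∣ {M} rad 4∣a with factorise M
... | record { factors = ps ; isFactorisation = refl ; factorsPrime = ps-prime } = ∏∣geom⇔∏∣ ps-prime rad 4∣a

PowOne⇔Multiple : ℕ → ℕ → ℕ → Set
PowOne⇔Multiple n q k = ∀ j → PowOne n q j ⇔ k ∣ j

powOne-* : ∀ n q e t → PowOne n q (e * t) ≡ PowOne n (q ^ e) t
powOne-* n q e t = cong (λ x → n ∣ x ∸ 1) (sym (^-*-assoc q e t))

powOne-1⇔ : ∀ {n q} → PowOne n q 1 ⇔ n ∣ q ∸ 1
powOne-1⇔ {n} {q} = mk⇔ (subst (λ x → n ∣ x ∸ 1) (*-identityʳ q))
                         (subst (λ x → n ∣ x ∸ 1) (sym (*-identityʳ q)))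

powOne-∣ : ∀ {n q i j} → PowOne n q i → i ∣ j → PowOne n q j
powOne-∣ {n} {q} {i} n∣q^i∸1 (divides t refl) =
  subst id (trans (sym (powOne-* n q i t)) (cong (PowOne n q) (*-comm i t)))
    (subst (n ∣_) (sym (^∸1≡[∸1]*geom (q ^ i) t)) (∣m⇒∣m*n _ n∣q^i∸1))

^+∸1 : ∀ q j i → q ^ (j + i) ∸ 1 ≡ q ^ j * (q ^ i ∸ 1) + (q ^ j ∸ 1)
^+∸1 q j i = begin
  q ^ (j + i) ∸ 1                                    ≡⟨ ^∸1≡[∸1]*geom q (j + i) ⟩
  (q ∸ 1) * geom q (j + i)                           ≡⟨ cong ((q ∸ 1) *_) (geom-+ q j i) ⟩
  (q ∸ 1) * (geom q j + q ^ j * geom q i)            ≡⟨ solve 4 (λ a x y z → a :* (x :+ y :* z) := y :* (a :* z) :+ a :* x) refl (q ∸ 1) (geom q j) (q ^ j) (geom q i) ⟩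
  q ^ j * ((q ∸ 1) * geom q i) + (q ∸ 1) * geom q j  ≡⟨ sym (cong₂ (λ x y → q ^ j * x + y) (^∸1≡[∸1]*geom q i) (^∸1≡[∸1]*geom q j)) ⟩
  q ^ j * (q ^ i ∸ 1) + (q ^ j ∸ 1)                  ∎
  where open ≡-Reasoning

powOne-+ : ∀ {n q i} j → PowOne n q i → PowOne n q (j + i) ⇔ PowOne n q j
powOne-+ {n} {q} {i} j n∣q^i∸1 = mk⇔
  (λ n∣q^[j+i]∸1 → ∣m+n∣m⇒∣n (subst (n ∣_) (^+∸1 q j i) n∣q^[j+i]∸1) n∣q^j*[q^i∸1])
  (λ n∣q^j∸1 → subst (n ∣_) (sym (^+∸1 q j i)) (∣m∣n⇒∣m+n n∣q^j*[q^i∸1] n∣q^j∸1))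
  where n∣q^j*[q^i∸1] = ∣n⇒∣m*n (q ^ j) n∣q^i∸1

∣+1⇒powOne-2 : ∀ {n q} → n ∣ q + 1 → PowOne n q 2
∣+1⇒powOne-2 {n} {q} n∣q+1 = subst (n ∣_) (sym (^∸1≡[∸1]*geom q 2))
  (∣n⇒∣m*n (q ∸ 1) (subst (n ∣_) (trans (+-comm q 1) (cong suc (sym (*-identityʳ q)))) n∣q+1))

isOrd⇒∣ : ∀ {n q k j} → IsOrd n q k → PowOne n q j → k ∣ j
isOrd⇒∣ {n} {q} {k@(suc _)} {j} (_ , n∣q^k∸1 , minimal) n∣q^j∸1 =
  m%n≡0⇒n∣m j k (remainder≡0 (j % k) (m%n<n j k) powOne-remainder)
  where
  powOne-remainder : PowOne n q (j % k)
  powOne-remainder = Equivalence.to (powOne-+ (j % k) (powOne-∣ n∣q^k∸1 (n∣m*n (j / k))))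
    (subst (PowOne n q) (m≡m%n+[m/n]*n j k) n∣q^j∸1)
  remainder≡0 : ∀ r → r < k → PowOne n q r → r ≡ 0
  remainder≡0 zero    _   _          = refl
  remainder≡0 (suc r) r<k powOne-1+r = ⊥-elim (minimal (suc r) (s≤s z≤n) r<k powOne-1+r)

powOne⇔Multiple⇒isOrd : ∀ {n q k} .{{_ : NonZero k}} → PowOne⇔Multiple n q k → IsOrd n q k
powOne⇔Multiple⇒isOrd {k = k} powOne⇔∣ =
  >-nonZero⁻¹ k , Equivalence.from (powOne⇔∣ k) ∣-refl ,
  λ j 1≤j j<k powOne-j → <⇒≱ j<k (∣⇒≤ {{>-nonZero 1≤j}} (Equivalence.to (powOne⇔∣ j) powOne-j))

powOne⇔Multiple-^ : ∀ {n q e m} .{{_ : NonZero e}} → (∀ {j} → PowOne n q j → e ∣ j) →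
                    PowOne⇔Multiple n (q ^ e) m → PowOne⇔Multiple n q (e * m)
powOne⇔Multiple-^ {n} {q} {e} {m} e∣ powOne⇔∣ = ⇔-from-multiples e e∣ (m*n∣⇒m∣ e m) λ t → begin
  PowOne n q (e * t)    ≡⟨ powOne-* n q e t ⟩
  PowOne n (q ^ e) t    ∼⟨ powOne⇔∣ t ⟩
  m ∣ t                 ∼⟨ ⇔-sym (*-cancelˡ-∣-⇔ e) ⟩
  e * m ∣ e * t         ∎
  where open Related.EquationalReasoning

lifting-exponent-split : ∀ {g M b} .{{_ : NonZero g}} .{{_ : NonZero M}} → g ∣ b → Coprime M (b / g) →
                         PrimeDivisorsDivide M b → (2 ∣ M → 4 ∣ b) → PowOne⇔Multiple (g * M) (suc b) M
lifting-exponent-split {g} {M} {b} g∣b M⊥b/g rad 4∣b j = begin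
  g * M ∣ suc b ^ j ∸ 1                 ≡⟨ cong (g * M ∣_) (^∸1≡[∸1]*geom (suc b) j) ⟩
  g * M ∣ b * geom (suc b) j            ≡⟨ cong (λ x → g * M ∣ x * geom (suc b) j) (sym (m*[n/m]≡n g∣b)) ⟩
  g * M ∣ g * (b / g) * geom (suc b) j  ≡⟨ cong (g * M ∣_) (*-assoc g (b / g) _) ⟩
  g * M ∣ g * (b / g * geom (suc b) j)  ∼⟨ *-cancelˡ-∣-⇔ g ⟩
  M ∣ b / g * geom (suc b) j            ∼⟨ coprime-∣*-⇔ M⊥b/g ⟩
  M ∣ geom (suc b) j                    ∼⟨ ∣geom⇔∣ rad 4∣b j ⟩
  M ∣ j                                 ∎
  where open Related.EquationalReasoning

lifting-exponent : ∀ {N b} → .{{NonZero N}} → PrimeDivisorsDivide N b → (4 ∣ N → 4 ∣ b) →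
                   PowOne⇔Multiple N (suc b) (N div gcd b N)
lifting-exponent {N} {b} rad 4∣b =
  subst₂ (λ n k → PowOne⇔Multiple n (suc b) k) (m*[n/m]≡n g∣N) (sym (div≡/ N g))
    (lifting-exponent-split {g} {M} (gcd[m,n]∣m b N) (Coprimality.sym (coprime-/gcd b N))
                            (λ r-prime → rad r-prime ∘ ∣M⇒∣N) 2∣M⇒4∣b)
  where
  g = gcd b N
  instance _ = gcd≢0ʳ b N
  M = N / g
  instance _ = ≢-nonZero (n/gcd[m,n]≢0 b N)
  g∣N = gcd[m,n]∣n b N
  ∣M⇒∣N : ∀ {r} → r ∣ M → r ∣ N
  ∣M⇒∣N r∣M = ∣-trans r∣M (m/n∣m g∣N)
  2∣M⇒4∣b : 2 ∣ M → 4 ∣ b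
  2∣M⇒4∣b 2∣M = 4∣b (subst (4 ∣_) (m*[n/m]≡n g∣N) (*-pres-∣ 2∣g 2∣M))
    where 2∣g = gcd-greatest (rad prime[2] (∣M⇒∣N 2∣M)) (∣M⇒∣N 2∣M)

isOrd-via-power : ∀ {N q e} .{{_ : NonZero N}} .{{_ : NonZero q}} .{{_ : NonZero e}} →
                  (∀ {j} → PowOne N q j → e ∣ j) → PrimeDivisorsDivide N (q ^ e ∸ 1) → (4 ∣ N → 4 ∣ q ^ e ∸ 1) →
                  IsOrd N q ((e * N) div gcd (q ^ e ∸ 1) N)
isOrd-via-power {N} {q} {e} e∣ rad 4∣ =
  subst (IsOrd N q) (sym (*-div-assoc e g (gcd[m,n]∣n B N))) (powOne⇔Multiple⇒isOrd (powOne⇔Multiple-^ e∣ ord-q^e))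
  where
  B = q ^ e ∸ 1
  g = gcd B N
  ord-q^e : PowOne⇔Multiple N (q ^ e) (N div g)
  ord-q^e = subst (λ c → PowOne⇔Multiple N c (N div g)) (suc[n∸1]≡n (q ^ e) {{m^n≢0 q e}}) (lifting-exponent rad 4∣)
  instance _ = gcd≢0ʳ B N
  instance _ = subst NonZero (sym (div≡/ N g)) (≢-nonZero (n/gcd[m,n]≢0 B N))
  instance _ = m*n≢0 e (N div g)

¬2∣⇒≡1+[n/2]*2 : ∀ {n} → ¬ 2 ∣ n → n ≡ 1 + (n / 2) * 2
¬2∣⇒≡1+[n/2]*2 {n} n-odd with n % 2 | m≡m%n+[m/n]*n n 2 | m%n<n n 2
... | 0 | n≡[n/2]*2 | _ = contradiction (divides (n / 2) n≡[n/2]*2) n-odd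
... | 1 | n≡1+[n/2]*2 | _ = n≡1+[n/2]*2
... | 2+ _ | _ | s≤s (s≤s ())

odd⇒4∣∸1⊎4∣+1 : ∀ {q} → ¬ 2 ∣ q → 4 ∣ q ∸ 1 ⊎ 4 ∣ q + 1
odd⇒4∣∸1⊎4∣+1 {q} q-odd with q % 4 | m≡m%n+[m/n]*n q 4 | m%n<n q 4
... | 0 | q≡ | _ = contradiction (divides (q / 4 * 2)
                      (trans q≡ (solve 1 (λ x → x :* con 4 := x :* con 2 :* con 2) refl (q / 4)))) q-odd
... | 1 | q≡ | _ = inj₁ (divides (q / 4) (cong (_∸ 1) q≡))
... | 2 | q≡ | _ = contradiction (divides (1 + q / 4 * 2)
                      (trans q≡ (solve 1 (λ x → con 2 :+ x :* con 4 := (con 1 :+ x :* con 2) :* con 2) refl (q / 4)))) q-odd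
... | 3 | q≡ | _ = inj₂ (divides (1 + q / 4)
                      (trans (cong (_+ 1) q≡) (solve 1 (λ x → con 3 :+ x :* con 4 :+ con 1 := (con 1 :+ x) :* con 4) refl (q / 4))))
... | suc (suc (suc (suc _))) | _ | s≤s (s≤s (s≤s (s≤s ())))

4∣∸1⇒4∤+1 : ∀ {q} → 4 ∣ q ∸ 1 → ¬ 4 ∣ q + 1
4∣∸1⇒4∤+1 {zero}  _       4∣1       with () ← ∣1⇒≡1 4∣1
4∣∸1⇒4∤+1 {suc a} 4∣a 4∣a+2 with ∣⇒≤ (∣m+n∣m⇒∣n (subst (4 ∣_) (sym (+-suc a 1)) 4∣a+2) 4∣a)
... | s≤s (s≤s ())

odd⇒powOne-4-2 : ∀ {q} → ¬ 2 ∣ q → PowOne 4 q 2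
odd⇒powOne-4-2 {q} q-odd with odd⇒4∣∸1⊎4∣+1 q-odd
... | inj₁ 4∣q∸1 = powOne-∣ {4} {q} (Equivalence.from (powOne-1⇔ {4} {q}) 4∣q∸1) (1∣ 2)
... | inj₂ 4∣q+1 = ∣+1⇒powOne-2 4∣q+1

≡3-mod4⇒¬powOne-4-odd : ∀ {q k} → 4 ∣ q + 1 → ¬ 2 ∣ k → ¬ PowOne 4 q k
≡3-mod4⇒¬powOne-4-odd {q} {k} 4∣q+1 k-odd powOne-k =
  4∣∸1⇒4∤+1 (Equivalence.to (powOne-1⇔ {4} {q}) powOne-1) 4∣q+1
  where
  powOne-even : PowOne 4 q (k / 2 * 2)
  powOne-even = powOne-∣ {4} {q} {2} (∣+1⇒powOne-2 4∣q+1) (n∣m*n (k / 2))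
  powOne-1 : PowOne 4 q 1
  powOne-1 = Equivalence.to (powOne-+ {4} {q} {k / 2 * 2} 1 powOne-even)
                            (subst (PowOne 4 q) (¬2∣⇒≡1+[n/2]*2 k-odd) powOne-k)

odd⇒powOne-4 : ∀ {q f} → ¬ 2 ∣ q → (4 ∣ q + 1 → ¬ 2 ∣ f → ⊥) → PowOne 4 q f
odd⇒powOne-4 {q} {f} q-odd ¬[≡3-mod4×f-odd] with 2 ∣? f | odd⇒4∣∸1⊎4∣+1 q-odd
... | yes 2∣f   | _          = powOne-∣ {4} {q} {2} (odd⇒powOne-4-2 q-odd) 2∣f
... | no  f-odd | inj₁ 4∣q∸1 = powOne-∣ {4} {q} (Equivalence.from (powOne-1⇔ {4} {q}) 4∣q∸1) (1∣ f)
... | no  f-odd | inj₂ 4∣q+1 = ⊥-elim (¬[≡3-mod4×f-odd] 4∣q+1 f-odd)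

2∣d⇒4∤d⇒4∣d*v⇒2∣v : ∀ {d v} → 2 ∣ d → ¬ 4 ∣ d → 4 ∣ d * v → 2 ∣ v
2∣d⇒4∤d⇒4∣d*v⇒2∣v {v = v} (divides d′ refl) 4∤d 4∣d*v =
  [ (λ 2∣d′ → contradiction (*-monoˡ-∣ 2 2∣d′) 4∤d) , id ]′ (euclidsLemma d′ v prime[2] 2∣d′*v)
  where
  2∣d′*v : 2 ∣ d′ * v
  2∣d′*v = *-cancelˡ-∣ 2 (subst (4 ∣_) (trans (cong (_* v) (*-comm d′ 2)) (*-assoc 2 d′ v)) 4∣d*v)

≡3-mod4⇒powOne⇒2*∣ : ∀ {n q f} → 4 ∣ q + 1 → ¬ 2 ∣ f → 4 ∣ n → (∀ {j} → PowOne n q j → f ∣ j) →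
                      ∀ {j} → PowOne n q j → 2 * f ∣ j
≡3-mod4⇒powOne⇒2*∣ {n} {q} {f} 4∣q+1 f-odd 4∣n f∣ {j} powOne-j with f∣ {j} powOne-j
... | divides i refl with 2 ∣? i
...   | yes (divides i′ refl) = divides i′ (*-assoc i′ 2 f)
...   | no i-odd = contradiction (∣-trans 4∣n powOne-j) (≡3-mod4⇒¬powOne-4-odd 4∣q+1 i*f-odd)
  where
  i*f-odd : ¬ 2 ∣ i * f
  i*f-odd 2∣i*f = [ i-odd , f-odd ]′ (euclidsLemma i f prime[2] 2∣i*f)

¬P⇒powOne-4 : ∀ {d q f v} → gcd d q ≡ 1 → PowOne d q f → PrimeDivisorsDivide (d * v) d →
              ¬ (P d q f × 2 ∣ v) → 4 ∣ d * v → PowOne 4 q f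
¬P⇒powOne-4 {d} {q} gcd≡1 d∣q^f∸1 rad ¬P 4∣d*v with 4 ∣? d
... | yes 4∣d = ∣-trans 4∣d d∣q^f∸1
... | no  4∤d = odd⇒powOne-4 q-odd λ 4∣q+1 f-odd →
  ¬P (((2∣d , 4∤d) , 4∣q+1 , f-odd) , 2∣d⇒4∤d⇒4∣d*v⇒2∣v 2∣d 4∤d 4∣d*v)
  where
  2∣d = rad prime[2] (∣-trans (divides 2 refl) 4∣d*v)
  q-odd : ¬ 2 ∣ q
  q-odd 2∣q = prime∤1 prime[2] (subst (2 ∣_) gcd≡1 (gcd-greatest 2∣d 2∣q))

lemma6p2 : (d q f : ℕ) → 1 ≤ d → 1 ≤ q → gcd d q ≡ 1 → IsOrd d q f →
    (v : ℕ) → 1 ≤ v → ∃[ m ] (v ∣ d ^ m) →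
      (P d q f → 2 ∣ v → IsOrd (d * v) q (((f * d * v) * 2) div gcd (q ^ (2 * f) ∸ 1) (d * v)))
      × (¬ (P d q f × 2 ∣ v) → IsOrd (d * v) q ((f * d * v) div gcd (q ^ f ∸ 1) (d * v)))
lemma6p2 d q f d≥1 q≥1 gcd≡1 ord@(f≥1 , d∣q^f∸1 , _) v v≥1 (m , v∣d^m) = case-P , case-¬P
  where
  instance
    _ = >-nonZero q≥1
    _ = >-nonZero f≥1
    _ = m*n≢0 2 f
    _ = m*n≢0 d v {{>-nonZero d≥1}} {{>-nonZero v≥1}}
  rad : PrimeDivisorsDivide (d * v) d
  rad = ∣^⇒primeDivisorsDivide m v∣d^m
  f∣ : ∀ {j} → PowOne (d * v) q j → f ∣ j
  f∣ = isOrd⇒∣ ord ∘ ∣-trans (m∣m*n v)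
  case-P : P d q f → 2 ∣ v → IsOrd (d * v) q (((f * d * v) * 2) div gcd (q ^ (2 * f) ∸ 1) (d * v))
  case-P ((2∣d , _) , 4∣q+1 , f-odd) 2∣v =
    subst (λ k → IsOrd (d * v) q (k div gcd (q ^ (2 * f) ∸ 1) (d * v)))
      (solve 3 (λ f d v → con 2 :* f :* (d :* v) := f :* d :* v :* con 2) refl f d v)
      (isOrd-via-power (≡3-mod4⇒powOne⇒2*∣ 4∣q+1 f-odd (*-pres-∣ 2∣d 2∣v) f∣)
        (λ r-prime r∣dv → ∣-trans (rad r-prime r∣dv) (powOne-∣ {d} {q} {f} d∣q^f∸1 (n∣m*n 2)))
        (λ _ → powOne-∣ {4} {q} {2} (∣+1⇒powOne-2 4∣q+1) (m∣m*n f)))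
  case-¬P : ¬ (P d q f × 2 ∣ v) → IsOrd (d * v) q ((f * d * v) div gcd (q ^ f ∸ 1) (d * v))
  case-¬P ¬P =
    subst (λ k → IsOrd (d * v) q (k div gcd (q ^ f ∸ 1) (d * v))) (sym (*-assoc f d v))
      (isOrd-via-power f∣ (λ r-prime r∣dv → ∣-trans (rad r-prime r∣dv) d∣q^f∸1)
                          (¬P⇒powOne-4 gcd≡1 d∣q^f∸1 rad ¬P))
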